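{- If $q=q(n)$ are integers with $0\le q=o(2^{n/2})$ as $n\to\infty$, then \[ (2q)!\,N(n,1,q)=\binom{2q}{q}^{n}\bigl(1+O(q^2/2^n)\bigr). \]
   Context: For integers $n\ge1$ and $0\le 2q\le 2^n$, $N(n,1,q)$ is the number of boolean functions $g:\{0,1\}^n\to\{0,1\}$ of weight $2q$ (exactly $2q$ inputs map to 1) such that for every coordinate $j\in\{1,\dots,n\}$ and every $b\in\{0,1\}$, exactly $q$ inputs $y$ with $y_j=b$ satisfy $g(y)=1$ (correlation-immune functions of order 1 and weight $2q$). -}

module Defs where

open import Data.Nat using (ℕ; zero; suc; _+_; _*_; _^_; _≡ᵇ_)
open import Data.Bool using (Bool; true; false; if_then_else_; _∧_)
open import Data.List using (List; []; _∷_; map; concatMap; length; filterᵇ; allFin; foldr)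
open import Data.Vec using (Vec; []; _∷_; lookup)
open import Data.Fin using (Fin)

-- The Boolean cube {0,1}^n, with 0 = false and 1 = true.
Cube : ℕ → Set
Cube n = Vec Bool n

BoolFun : ℕ → Set
BoolFun n = Cube n → Bool

allInputs : (n : ℕ) → List (Cube n)
allInputs zero    = [] ∷ []
allInputs (suc n) = map (false ∷_) (allInputs n) Data.List.++ map (true ∷_) (allInputs n)

-- All Boolean functions on {0,1}^n, each (up to pointwise equality) exactly once:
-- a function on {0,1}^(n+1) is given by its two restrictions (first bit 0 / 1).
allFuns : (n : ℕ) → List (BoolFun n)
allFuns zero    = (λ _ → false) ∷ (λ _ → true) ∷ []
allFuns (suc n) =
  concatMap (λ g₀ → map (λ g₁ → λ { (b ∷ y) → if b then g₁ y else g₀ y }) (allFuns n)) (allFuns n)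

allᵇ : {A : Set} → (A → Bool) → List A → Bool
allᵇ p = foldr (λ x r → p x ∧ r) true

countᵇ : {n : ℕ} → (Cube n → Bool) → ℕ
countᵇ {n} P = length (filterᵇ P (allInputs n))

_≟ᵇ_ : Bool → Bool → Bool
true  ≟ᵇ b = b
false ≟ᵇ true = false
false ≟ᵇ false = true

weight : {n : ℕ} → BoolFun n → ℕ
weight g = countᵇ g

isCI1 : (n q : ℕ) → BoolFun n → Bool
isCI1 n q g =
  (weight g ≡ᵇ 2 * q) ∧
  allᵇ (λ j → allᵇ (λ b → countᵇ (λ y → (lookup y j ≟ᵇ b) ∧ g y) ≡ᵇ q) (false ∷ true ∷ []))
      (allFin n)

N : ℕ → ℕ → ℕ
N n q = length (filterᵇ (isCI1 n q) (allFuns n))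

-- A correlation-immune function of weight 2q, listed along an ordering of its support, is a
-- 2q-tuple of distinct points of {0,1}^n each of whose n coordinate columns has weight q, so
-- (2q)! N(n,1,q) counts such "balanced" tuples of distinct points.  Balanced tuples, distinct
-- or not, factor over the columns: there are C(2q,q)^n of them.  A balanced tuple with
-- x_i = x_j (i ≠ j) has columns of weight q that agree at i and j, and at most half of the
-- C(2q,q) weight-q columns do, because the middle binomial coefficient is the largest.
-- Summing over the (2q)^2 pairs (i,j) gives, for all n and q,
--   0 ≤ C(2q,q)^n − (2q)! N(n,1,q) ≤ (2q)^2 C(2q,q)^n / 2^n.

module Submission where

open import Defs

open import Algebra.Bundles using (CommutativeMonoid)
open import Data.Bool using (Bool; true; false; _∧_; _∨_; not; T)
open import Data.Bool.Properties using (∧-zeroʳ; ∧-identityʳ; ∧-comm; ∧-assoc; ∧-commutativeMonoid)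
open import Data.Fin using (Fin; zero; suc; punchIn; punchOut; _≟_)
open import Data.Fin.Properties using (punchIn-punchOut; suc-injective)
open import Data.List using (List; []; _∷_; map; concatMap; length; filterᵇ; allFin; _++_; tabulate)
open import Data.List.Membership.Propositional using (_∈_)
open import Data.List.Membership.Propositional.Properties using (∈-++⁺ˡ; ∈-++⁺ʳ; ∈-map⁺; ∈-allFin)
open import Data.List.Properties using (length-tabulate)
open import Data.List.Relation.Unary.Any using (here; there)
open import Data.Nat using (ℕ; zero; suc; _+_; _*_; _^_; _≤_; _!; ∣_-_∣; _≡ᵇ_; _∸_; z≤n)
open import Data.Nat.Combinatorics using (_C_; nC1≡n; nCk+nC[k+1]≡[n+1]C[k+1])
open import Data.Nat.Combinatorics.Base using (_P′_)
open import Data.Nat.Combinatorics.Specification using (nP′n≡n!)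
open import Data.Nat.Properties hiding (_≟_; suc-injective)
open import Data.Nat.Tactic.RingSolver using (solve-∀)
open import Data.Product using (∃-syntax; _,_; _×_; Σ; proj₁; proj₂)
open import Data.Sum using (_⊎_; inj₁; inj₂)
open import Data.Unit using (tt)
open import Data.Vec using (Vec; []; _∷_; lookup; insertAt; toList)
import Data.Vec as Vec
open import Data.Vec.Properties
  using (length-toList; toList-map; lookup-map; insertAt-lookup; insertAt-punchIn)
open import Function using (_∘_)
open import Relation.Binary.PropositionalEquality
open import Relation.Nullary using (does; yes; no)
open import Relation.Nullary.Decidable using (dec-false)

open import Algebra.Properties.CommutativeSemigroup +-commutativeSemigroup
  using () renaming (interchange to +-interchange; x∙yz≈y∙xz to +-leftComm)
open import Algebra.Properties.CommutativeSemigroup *-commutativeSemigroup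
  using () renaming (interchange to *-interchange)
open import Algebra.Properties.CommutativeSemigroup
  (CommutativeMonoid.commutativeSemigroup ∧-commutativeMonoid)
  using () renaming (interchange to ∧-interchange)

private variable
  A B : Set

∧-true⁻ : ∀ {a b} → a ∧ b ≡ true → a ≡ true × b ≡ true
∧-true⁻ {true} {true} _ = refl , refl

∨-true⁻ : ∀ {a b} → a ∨ b ≡ true → a ≡ true ⊎ b ≡ true
∨-true⁻ {true}  _ = inj₁ refl
∨-true⁻ {false} b = inj₂ b

not-true⁻ : ∀ {a} → not a ≡ true → a ≡ false
not-true⁻ {false} _ = refl

≟ᵇ⇒≡ : ∀ a b → (a ≟ᵇ b) ≡ true → a ≡ b
≟ᵇ⇒≡ true  true  _ = refl
≟ᵇ⇒≡ false false _ = refl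

≟ᵇ-refl : ∀ a → (a ≟ᵇ a) ≡ true
≟ᵇ-refl true  = refl
≟ᵇ-refl false = refl

≡ᵇ-refl : ∀ m → (m ≡ᵇ m) ≡ true
≡ᵇ-refl zero    = refl
≡ᵇ-refl (suc m) = ≡ᵇ-refl m

≡ᵇ-true⁻ : ∀ {m n} → (m ≡ᵇ n) ≡ true → m ≡ n
≡ᵇ-true⁻ {m} {n} eq = ≡ᵇ⇒≡ m n (subst T (sym eq) tt)

allᵇ-true⁻ : (p : A → Bool) {xs : List A} → allᵇ p xs ≡ true → {x : A} → x ∈ xs → p x ≡ true
allᵇ-true⁻ p {x ∷ xs} all≡ (here refl) = proj₁ (∧-true⁻ {p x} all≡)
allᵇ-true⁻ p {x ∷ xs} all≡ (there x∈xs) = allᵇ-true⁻ p (proj₂ (∧-true⁻ {p x} all≡)) x∈xs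

allᵇ-true⁺ : (p : A → Bool) → (∀ x → p x ≡ true) → (xs : List A) → allᵇ p xs ≡ true
allᵇ-true⁺ p p≡ []       = refl
allᵇ-true⁺ p p≡ (x ∷ xs) rewrite p≡ x = allᵇ-true⁺ p p≡ xs

allᵇ-++ : (p : A → Bool) (xs ys : List A) → allᵇ p (xs ++ ys) ≡ allᵇ p xs ∧ allᵇ p ys
allᵇ-++ p []       ys = refl
allᵇ-++ p (x ∷ xs) ys rewrite allᵇ-++ p xs ys = sym (∧-assoc (p x) _ _)

allᵇ-map : (p : B → Bool) (f : A → B) (xs : List A) → allᵇ p (map f xs) ≡ allᵇ (p ∘ f) xs
allᵇ-map p f []       = refl
allᵇ-map p f (x ∷ xs) = cong (p (f x) ∧_) (allᵇ-map p f xs)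

-- Finite sums and counting

∑ : (A → ℕ) → List A → ℕ
∑ f []       = 0
∑ f (x ∷ xs) = f x + ∑ f xs

syntax ∑ (λ x → e) xs = ∑[ x ∈ xs ] e

𝟙 : Bool → ℕ
𝟙 true  = 1
𝟙 false = 0

count : (A → Bool) → List A → ℕ
count p = ∑ (𝟙 ∘ p)

length-filterᵇ : (p : A → Bool) (xs : List A) → length (filterᵇ p xs) ≡ count p xs
length-filterᵇ p []       = refl
length-filterᵇ p (x ∷ xs) with p x
... | true  = cong suc (length-filterᵇ p xs)
... | false = length-filterᵇ p xs

∑-cong : {f g : A → ℕ} → (∀ x → f x ≡ g x) → (xs : List A) → ∑ f xs ≡ ∑ g xs
∑-cong f≗g []       = refl
∑-cong f≗g (x ∷ xs) = cong₂ _+_ (f≗g x) (∑-cong f≗g xs)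

∑-mono-≤ : {f g : A → ℕ} → (∀ x → f x ≤ g x) → (xs : List A) → ∑ f xs ≤ ∑ g xs
∑-mono-≤ f≤g []       = z≤n
∑-mono-≤ f≤g (x ∷ xs) = +-mono-≤ (f≤g x) (∑-mono-≤ f≤g xs)

∑-zero : {f : A → ℕ} → (∀ x → f x ≡ 0) → (xs : List A) → ∑ f xs ≡ 0
∑-zero f≗0 []       = refl
∑-zero f≗0 (x ∷ xs) rewrite f≗0 x = ∑-zero f≗0 xs

∑-++ : (f : A → ℕ) (xs ys : List A) → ∑ f (xs ++ ys) ≡ ∑ f xs + ∑ f ys
∑-++ f []       ys = refl
∑-++ f (x ∷ xs) ys = trans (cong (f x +_) (∑-++ f xs ys)) (sym (+-assoc (f x) _ _))

∑-map : (f : B → ℕ) (g : A → B) (xs : List A) → ∑ f (map g xs) ≡ ∑ (f ∘ g) xs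
∑-map f g []       = refl
∑-map f g (x ∷ xs) = cong (f (g x) +_) (∑-map f g xs)

∑-concatMap : (f : B → ℕ) (g : A → List B) (xs : List A) →
  ∑ f (concatMap g xs) ≡ ∑[ x ∈ xs ] ∑ f (g x)
∑-concatMap f g []       = refl
∑-concatMap f g (x ∷ xs) =
  trans (∑-++ f (g x) (concatMap g xs)) (cong (∑ f (g x) +_) (∑-concatMap f g xs))

∑-distrib-+ : (f g : A → ℕ) (xs : List A) → ∑[ x ∈ xs ] (f x + g x) ≡ ∑ f xs + ∑ g xs
∑-distrib-+ f g []       = refl
∑-distrib-+ f g (x ∷ xs) rewrite ∑-distrib-+ f g xs = +-interchange (f x) (g x) (∑ f xs) (∑ g xs)

∑-*ˡ : (c : ℕ) (f : A → ℕ) (xs : List A) → ∑[ x ∈ xs ] (c * f x) ≡ c * ∑ f xs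
∑-*ˡ c f []       = sym (*-zeroʳ c)
∑-*ˡ c f (x ∷ xs) = trans (cong (c * f x +_) (∑-*ˡ c f xs)) (sym (*-distribˡ-+ c (f x) _))

∑-comm : (f : A → B → ℕ) (xs : List A) (ys : List B) →
  ∑[ x ∈ xs ] ∑[ y ∈ ys ] f x y ≡ ∑[ y ∈ ys ] ∑[ x ∈ xs ] f x y
∑-comm f []       ys = sym (∑-zero (λ _ → refl) ys)
∑-comm f (x ∷ xs) ys =
  trans (cong (∑ (f x) ys +_) (∑-comm f xs ys)) (sym (∑-distrib-+ (f x) (λ y → ∑[ x ∈ xs ] f x y) ys))

∑-≥-element : (f : A → ℕ) {x : A} {xs : List A} → x ∈ xs → f x ≤ ∑ f xs
∑-≥-element f {xs = y ∷ ys} (here refl) = m≤m+n (f y) _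
∑-≥-element f {xs = y ∷ ys} (there x∈ys) = ≤-trans (∑-≥-element f x∈ys) (m≤n+m _ (f y))

∑-*ʳ-≤-length* : (f : A → ℕ) (c d : ℕ) → (∀ x → f x * c ≤ d) → (xs : List A) →
  ∑ f xs * c ≤ length xs * d
∑-*ʳ-≤-length* f c d fc≤d []       = z≤n
∑-*ʳ-≤-length* f c d fc≤d (x ∷ xs) rewrite *-distribʳ-+ c (f x) (∑ f xs) =
  +-mono-≤ (fc≤d x) (∑-*ʳ-≤-length* f c d fc≤d xs)

count≡0⇒false : (p : A → Bool) (xs : List A) → count p xs ≡ 0 → {x : A} → x ∈ xs → p x ≡ false
count≡0⇒false p (y ∷ ys) count≡0 (here refl) with p y | count≡0
... | false | _ = refl
count≡0⇒false p (y ∷ ys) count≡0 (there x∈ys) with p y | count≡0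
... | false | count≡0′ = count≡0⇒false p ys count≡0′ x∈ys

𝟙-∧ : ∀ a b → 𝟙 (a ∧ b) ≡ 𝟙 a * 𝟙 b
𝟙-∧ false b = refl
𝟙-∧ true  b = sym (+-identityʳ (𝟙 b))

𝟙-split : ∀ a b → 𝟙 (a ∧ b) + 𝟙 (a ∧ not b) ≡ 𝟙 a
𝟙-split false b     = refl
𝟙-split true  false = refl
𝟙-split true  true  = refl

𝟙-∧-∨-disjoint : ∀ a b c → (b ≡ true → c ≡ false) →
  𝟙 (a ∧ (b ∨ c)) ≡ 𝟙 (a ∧ b) + 𝟙 (a ∧ c)
𝟙-∧-∨-disjoint false b     c b⇒¬c = refl
𝟙-∧-∨-disjoint true  true  c b⇒¬c rewrite b⇒¬c refl = refl
𝟙-∧-∨-disjoint true  false c b⇒¬c = refl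

count-allᵇ : (p : A → Bool) (xs : List A) → allᵇ p xs ≡ true → count p xs ≡ length xs
count-allᵇ p []       _     = refl
count-allᵇ p (x ∷ xs) all≡ with ∧-true⁻ {p x} all≡
... | px , all≡′ rewrite px = cong suc (count-allᵇ p xs all≡′)

count-true : (xs : List A) → count (λ _ → true) xs ≡ length xs
count-true []       = refl
count-true (x ∷ xs) = cong suc (count-true xs)

⋀ : (n : ℕ) → (Fin n → Bool) → Bool
⋀ zero    f = true
⋀ (suc n) f = f zero ∧ ⋀ n (f ∘ suc)

∏ : (n : ℕ) → (Fin n → ℕ) → ℕ
∏ zero    f = 1
∏ (suc n) f = f zero * ∏ n (f ∘ suc)

⋀-cong : (n : ℕ) {f g : Fin n → Bool} → (∀ j → f j ≡ g j) → ⋀ n f ≡ ⋀ n g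
⋀-cong zero    f≗g = refl
⋀-cong (suc n) f≗g = cong₂ _∧_ (f≗g zero) (⋀-cong n (f≗g ∘ suc))

∏-cong : (n : ℕ) {f g : Fin n → ℕ} → (∀ j → f j ≡ g j) → ∏ n f ≡ ∏ n g
∏-cong zero    f≗g = refl
∏-cong (suc n) f≗g = cong₂ _*_ (f≗g zero) (∏-cong n (f≗g ∘ suc))

∏-const : (n c : ℕ) → ∏ n (λ _ → c) ≡ c ^ n
∏-const zero    c = refl
∏-const (suc n) c = cong (c *_) (∏-const n c)

allᵇ-tabulate : (n : ℕ) (p : A → Bool) (f : Fin n → A) → allᵇ p (tabulate f) ≡ ⋀ n (p ∘ f)
allᵇ-tabulate zero    p f = refl
allᵇ-tabulate (suc n) p f = cong (p (f zero) ∧_) (allᵇ-tabulate n p (f ∘ suc))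

⋀-∧ : (n : ℕ) (f g : Fin n → Bool) → ⋀ n f ∧ ⋀ n g ≡ ⋀ n (λ j → f j ∧ g j)
⋀-∧ zero    f g = refl
⋀-∧ (suc n) f g = trans (∧-interchange (f zero) (⋀ n (f ∘ suc)) (g zero) (⋀ n (g ∘ suc)))
  (cong ((f zero ∧ g zero) ∧_) (⋀-∧ n (f ∘ suc) (g ∘ suc)))

𝟙-⋀ : (n : ℕ) (f : Fin n → Bool) → 𝟙 (⋀ n f) ≡ ∏ n (𝟙 ∘ f)
𝟙-⋀ zero    f = refl
𝟙-⋀ (suc n) f = trans (𝟙-∧ (f zero) _) (cong (𝟙 (f zero) *_) (𝟙-⋀ n (f ∘ suc)))

-- Binomial coefficients

[k+1]*nC[k+1]+k*nCk≡n*nCk : ∀ n k → suc k * (n C suc k) + k * (n C k) ≡ n * (n C k)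
[k+1]*nC[k+1]+k*nCk≡n*nCk zero    zero    = refl
[k+1]*nC[k+1]+k*nCk≡n*nCk zero    (suc k) rewrite *-zeroʳ (suc (suc k)) = refl
[k+1]*nC[k+1]+k*nCk≡n*nCk (suc n) zero    =
  trans (+-identityʳ _) (trans (*-identityˡ _) (trans (nC1≡n (suc n)) (sym (*-identityʳ (suc n)))))
[k+1]*nC[k+1]+k*nCk≡n*nCk (suc n) (suc k) = begin
  (2 + k) * (suc n C suc (suc k)) + (1 + k) * (suc n C suc k)
    ≡⟨ sym (cong₂ (λ x y → (2 + k) * x + (1 + k) * y)
                  (nCk+nC[k+1]≡[n+1]C[k+1] n (suc k)) (nCk+nC[k+1]≡[n+1]C[k+1] n k)) ⟩
  (2 + k) * (b + c) + (1 + k) * (a + b)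
    ≡⟨ regroup k a b c ⟩
  ((2 + k) * c + (1 + k) * b) + ((1 + k) * b + k * a) + (a + b)
    ≡⟨ cong₂ (λ x y → x + y + (a + b)) ([k+1]*nC[k+1]+k*nCk≡n*nCk n (suc k)) ([k+1]*nC[k+1]+k*nCk≡n*nCk n k) ⟩
  n * b + n * a + (a + b)
    ≡⟨ collect n a b ⟩
  (1 + n) * (a + b)
    ≡⟨ cong ((1 + n) *_) (nCk+nC[k+1]≡[n+1]C[k+1] n k) ⟩
  (1 + n) * (suc n C suc k) ∎
  where
  open ≡-Reasoning
  a = n C k
  b = n C suc k
  c = n C suc (suc k)
  regroup : ∀ k x y z → (2 + k) * (y + z) + (1 + k) * (x + y)
                      ≡ ((2 + k) * z + (1 + k) * y) + ((1 + k) * y + k * x) + (x + y)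
  regroup = solve-∀
  collect : ∀ n x y → n * y + n * x + (x + y) ≡ (1 + n) * (x + y)
  collect = solve-∀

nC[k+1]≤nCk : ∀ {n k} → n ≤ k + suc k → n C suc k ≤ n C k
nC[k+1]≤nCk {n} {k} n≤2k+1 = *-cancelˡ-≤ (suc k) (+-cancelʳ-≤ (k * Y) (suc k * X) (suc k * Y) (begin
  suc k * X + k * Y ≡⟨ [k+1]*nC[k+1]+k*nCk≡n*nCk n k ⟩
  n * Y             ≤⟨ *-monoˡ-≤ Y n≤2k+1 ⟩
  (k + suc k) * Y   ≡⟨ trans (*-distribʳ-+ Y k (suc k)) (+-comm (k * Y) _) ⟩
  suc k * Y + k * Y ∎))
  where
  open ≤-Reasoning
  X = n C suc k
  Y = n C k

nCk≤nC[k+1] : ∀ {n k} → k + suc k ≤ n → n C k ≤ n C suc k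
nCk≤nC[k+1] {n} {k} 2k+1≤n = *-cancelˡ-≤ (suc k) (+-cancelʳ-≤ (k * Y) (suc k * Y) (suc k * X) (begin
  suc k * Y + k * Y ≡⟨ trans (+-comm _ (k * Y)) (sym (*-distribʳ-+ Y k (suc k))) ⟩
  (k + suc k) * Y   ≤⟨ *-monoˡ-≤ Y 2k+1≤n ⟩
  n * Y             ≡⟨ sym ([k+1]*nC[k+1]+k*nCk≡n*nCk n k) ⟩
  suc k * X + k * Y ∎))
  where
  open ≤-Reasoning
  X = n C suc k
  Y = n C k

^-distribʳ-* : ∀ a b n → (a * b) ^ n ≡ a ^ n * b ^ n
^-distribʳ-* a b zero    = refl
^-distribʳ-* a b (suc n) rewrite ^-distribʳ-* a b n = *-interchange a b (a ^ n) (b ^ n)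

-- The cube

allInputs-complete : (n : ℕ) (y : Cube n) → y ∈ allInputs n
allInputs-complete zero    []          = here refl
allInputs-complete (suc n) (false ∷ y) = ∈-++⁺ˡ (∈-map⁺ (false ∷_) (allInputs-complete n y))
allInputs-complete (suc n) (true ∷ y)  =
  ∈-++⁺ʳ (map (false ∷_) (allInputs n)) (∈-map⁺ (true ∷_) (allInputs-complete n y))

∑-cube : (n : ℕ) (f : Cube (suc n) → ℕ) →
  ∑ f (allInputs (suc n)) ≡ ∑[ y ∈ allInputs n ] f (false ∷ y) + ∑[ y ∈ allInputs n ] f (true ∷ y)
∑-cube n f = trans (∑-++ f (map (false ∷_) (allInputs n)) _)
  (cong₂ _+_ (∑-map f (false ∷_) (allInputs n)) (∑-map f (true ∷_) (allInputs n)))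

∑-insertAt : (n : ℕ) (i : Fin (suc n)) (f : Cube (suc n) → ℕ) →
  ∑ f (allInputs (suc n)) ≡
    ∑[ y ∈ allInputs n ] f (insertAt y i false) + ∑[ y ∈ allInputs n ] f (insertAt y i true)
∑-insertAt n       zero    f = ∑-cube n f
∑-insertAt (suc n) (suc i) f = begin
  ∑ f (allInputs (suc (suc n)))
    ≡⟨ ∑-cube (suc n) f ⟩
  ∑[ y ∈ allInputs (suc n) ] f (false ∷ y) + ∑[ y ∈ allInputs (suc n) ] f (true ∷ y)
    ≡⟨ cong₂ _+_ (∑-insertAt n i (λ y → f (false ∷ y))) (∑-insertAt n i (λ y → f (true ∷ y))) ⟩
  (S false false + S false true) + (S true false + S true true)
    ≡⟨ +-interchange (S false false) (S false true) (S true false) (S true true) ⟩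
  (S false false + S true false) + (S false true + S true true)
    ≡⟨ sym (cong₂ _+_ (∑-cube n (λ y → f (insertAt y (suc i) false)))
                      (∑-cube n (λ y → f (insertAt y (suc i) true)))) ⟩
  ∑[ y ∈ allInputs (suc n) ] f (insertAt y (suc i) false)
    + ∑[ y ∈ allInputs (suc n) ] f (insertAt y (suc i) true) ∎
  where
  open ≡-Reasoning
  S : Bool → Bool → ℕ
  S a b = ∑[ y ∈ allInputs n ] f (a ∷ insertAt y i b)

∑-cube-∏ : (n : ℕ) (h : Fin n → Bool → ℕ) →
  ∑[ x ∈ allInputs n ] ∏ n (λ j → h j (lookup x j)) ≡ ∏ n (λ j → h j false + h j true)
∑-cube-∏ zero    h = refl
∑-cube-∏ (suc n) h = begin
  ∑[ x ∈ allInputs (suc n) ] ∏ (suc n) (λ j → h j (lookup x j))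
    ≡⟨ ∑-cube n _ ⟩
  ∑[ y ∈ allInputs n ] (h zero false * rest y) + ∑[ y ∈ allInputs n ] (h zero true * rest y)
    ≡⟨ cong₂ _+_ (∑-*ˡ (h zero false) rest (allInputs n)) (∑-*ˡ (h zero true) rest (allInputs n)) ⟩
  h zero false * ∑ rest (allInputs n) + h zero true * ∑ rest (allInputs n)
    ≡⟨ sym (*-distribʳ-+ (∑ rest (allInputs n)) (h zero false) (h zero true)) ⟩
  (h zero false + h zero true) * ∑ rest (allInputs n)
    ≡⟨ cong ((h zero false + h zero true) *_) (∑-cube-∏ n (h ∘ suc)) ⟩
  ∏ (suc n) (λ j → h j false + h j true) ∎
  where
  open ≡-Reasoning
  rest : Cube n → ℕ
  rest y = ∏ n (λ j → h (suc j) (lookup y j))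

_==_ : {n : ℕ} → Cube n → Cube n → Bool
[]      == []      = true
(a ∷ x) == (b ∷ y) = (a ≟ᵇ b) ∧ (x == y)

==-refl : {n : ℕ} (x : Cube n) → (x == x) ≡ true
==-refl []          = refl
==-refl (false ∷ x) = ==-refl x
==-refl (true ∷ x)  = ==-refl x

==⇒≡ : {n : ℕ} (x y : Cube n) → (x == y) ≡ true → x ≡ y
==⇒≡ []          []          _  = refl
==⇒≡ (false ∷ x) (false ∷ y) eq = cong (false ∷_) (==⇒≡ x y eq)
==⇒≡ (true ∷ x)  (true ∷ y)  eq = cong (true ∷_) (==⇒≡ x y eq)

==-⋀ : {n : ℕ} (x y : Cube n) → (x == y) ≡ ⋀ n (λ j → lookup x j ≟ᵇ lookup y j)
==-⋀ []      []      = refl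
==-⋀ (a ∷ x) (b ∷ y) = cong ((a ≟ᵇ b) ∧_) (==-⋀ x y)

count-∧-== : (n : ℕ) (f : Cube n → Bool) (x : Cube n) →
  count (λ y → f y ∧ (y == x)) (allInputs n) ≡ 𝟙 (f x)
count-∧-== zero    f []          rewrite ∧-identityʳ (f []) = +-identityʳ _
count-∧-== (suc n) f (false ∷ x) = begin
  count (λ y → f y ∧ (y == (false ∷ x))) (allInputs (suc n))
    ≡⟨ ∑-cube n _ ⟩
  count (λ y → f (false ∷ y) ∧ (y == x)) (allInputs n) + count (λ y → f (true ∷ y) ∧ false) (allInputs n)
    ≡⟨ cong₂ _+_ (count-∧-== n (λ y → f (false ∷ y)) x)
                 (∑-zero (λ y → cong 𝟙 (∧-zeroʳ (f (true ∷ y)))) (allInputs n)) ⟩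
  𝟙 (f (false ∷ x)) + 0
    ≡⟨ +-identityʳ _ ⟩
  𝟙 (f (false ∷ x)) ∎
  where open ≡-Reasoning
count-∧-== (suc n) f (true ∷ x) = begin
  count (λ y → f y ∧ (y == (true ∷ x))) (allInputs (suc n))
    ≡⟨ ∑-cube n _ ⟩
  count (λ y → f (false ∷ y) ∧ false) (allInputs n) + count (λ y → f (true ∷ y) ∧ (y == x)) (allInputs n)
    ≡⟨ cong₂ _+_ (∑-zero (λ y → cong 𝟙 (∧-zeroʳ (f (false ∷ y)))) (allInputs n))
                 (count-∧-== n (λ y → f (true ∷ y)) x) ⟩
  𝟙 (f (true ∷ x)) ∎
  where open ≡-Reasoning

wt : {k : ℕ} → Vec Bool k → ℕ
wt v = count (λ b → b) (toList v)

count-wt≡ᵇ : (m k : ℕ) → count (λ v → wt v ≡ᵇ k) (allInputs m) ≡ m C k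
count-wt≡ᵇ zero    zero    = refl
count-wt≡ᵇ zero    (suc k) = refl
count-wt≡ᵇ (suc m) zero    =
  trans (∑-cube m _) (cong₂ _+_ (count-wt≡ᵇ m zero) (∑-zero (λ _ → refl) (allInputs m)))
count-wt≡ᵇ (suc m) (suc k) =
  trans (∑-cube m _) (trans (cong₂ _+_ (count-wt≡ᵇ m (suc k)) (count-wt≡ᵇ m k))
    (trans (+-comm (m C suc k) (m C k)) (nCk+nC[k+1]≡[n+1]C[k+1] m k)))

wt-insertAt : {m : ℕ} (v : Vec Bool m) (i : Fin (suc m)) (b : Bool) → wt (insertAt v i b) ≡ 𝟙 b + wt v
wt-insertAt v       zero    b = refl
wt-insertAt (c ∷ v) (suc i) b = trans (cong (𝟙 c +_) (wt-insertAt v i b)) (+-leftComm (𝟙 c) (𝟙 b) (wt v))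

count-by-pair : (m : ℕ) (i : Fin (2 + m)) (j : Fin (1 + m)) (P : ℕ → Bool → Bool → Bool) →
  let Q : Bool → Bool → ℕ
      Q b b′ = count (λ w → P (𝟙 b + (𝟙 b′ + wt w)) b b′) (allInputs m)
  in count (λ v → P (wt v) (lookup v i) (lookup v (punchIn i j))) (allInputs (2 + m))
       ≡ (Q false false + Q false true) + (Q true false + Q true true)
count-by-pair m i j P = begin
  ∑ f (allInputs (2 + m))
    ≡⟨ ∑-insertAt (1 + m) i f ⟩
  ∑[ u ∈ allInputs (1 + m) ] f (insertAt u i false) + ∑[ u ∈ allInputs (1 + m) ] f (insertAt u i true)
    ≡⟨ cong₂ _+_ (∑-insertAt m j (λ u → f (insertAt u i false)))
                 (∑-insertAt m j (λ u → f (insertAt u i true))) ⟩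
  (R false false + R false true) + (R true false + R true true)
    ≡⟨ cong₂ _+_ (cong₂ _+_ (R≡Q false false) (R≡Q false true))
                 (cong₂ _+_ (R≡Q true false) (R≡Q true true)) ⟩
  (Q false false + Q false true) + (Q true false + Q true true) ∎
  where
  open ≡-Reasoning
  f : Cube (2 + m) → ℕ
  f v = 𝟙 (P (wt v) (lookup v i) (lookup v (punchIn i j)))
  R Q : Bool → Bool → ℕ
  R b b′ = ∑[ w ∈ allInputs m ] f (insertAt (insertAt w j b′) i b)
  Q b b′ = count (λ w → P (𝟙 b + (𝟙 b′ + wt w)) b b′) (allInputs m)
  R≡Q : ∀ b b′ → R b b′ ≡ Q b b′
  R≡Q b b′ = ∑-cong (λ w → cong 𝟙 (cong₂ (λ x (yz : Bool × Bool) → P x (proj₁ yz) (proj₂ yz))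
    (trans (wt-insertAt (insertAt w j b′) i b) (cong (𝟙 b +_) (wt-insertAt w j b′)))
    (cong₂ _,_ (insertAt-lookup (insertAt w j b′) i b)
               (trans (insertAt-punchIn (insertAt w j b′) i b j) (insertAt-lookup w j b′))))) (allInputs m)

weight-layer-above-middle : ∀ r →
  count (λ w → wt w ≡ᵇ suc r) (allInputs (r + r)) ≤ count (λ w → wt w ≡ᵇ r) (allInputs (r + r))
weight-layer-above-middle r = subst₂ _≤_ (sym (count-wt≡ᵇ (r + r) (suc r))) (sym (count-wt≡ᵇ (r + r) r))
  (nC[k+1]≤nCk (+-monoʳ-≤ r (n≤1+n r)))

weight-layer-below-middle : ∀ r →
  count (λ w → suc (wt w) ≡ᵇ r) (allInputs (r + r)) ≤ count (λ w → wt w ≡ᵇ r) (allInputs (r + r))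
weight-layer-below-middle zero    = z≤n
weight-layer-below-middle (suc r) =
  subst₂ _≤_ (sym (count-wt≡ᵇ (suc r + suc r) r)) (sym (count-wt≡ᵇ (suc r + suc r) (suc r)))
    (nCk≤nC[k+1] (+-monoˡ-≤ (suc r) (n≤1+n r)))

-- Splitting off the coordinates i and j, the columns with v_i = v_j make up the weight layers q
-- and q − 2 of {0,1}^(2q−2), and the others twice the layer q − 1, which is the largest.
column-pair-bound : ∀ {m} r → m ≡ 2 + (r + r) → (i j : Fin m) → i ≢ j →
  count (λ v → (lookup v i ≟ᵇ lookup v j) ∧ (wt v ≡ᵇ suc r)) (allInputs m) * 2
    ≤ count (λ v → wt v ≡ᵇ suc r) (allInputs m)
column-pair-bound r refl i j i≢j =
  subst (λ j → E j * 2 ≤ count (λ v → wt v ≡ᵇ suc r) (allInputs (2 + (r + r))))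
        (punchIn-punchOut i≢j) (bound (punchOut i≢j))
  where
  open ≤-Reasoning
  layer : ℕ → ℕ
  layer o = count (λ w → o + wt w ≡ᵇ suc r) (allInputs (r + r))
  E : Fin (2 + (r + r)) → ℕ
  E j = count (λ v → (lookup v i ≟ᵇ lookup v j) ∧ (wt v ≡ᵇ suc r)) (allInputs (2 + (r + r)))
  none : ∑ (λ _ → 0) (allInputs (r + r)) ≡ 0
  none = ∑-zero (λ _ → refl) (allInputs (r + r))
  double-≤ : ∀ a b c → a ≤ b → c ≤ b → (a + c) * 2 ≤ (a + b) + (b + c)
  double-≤ a b c a≤b c≤b = subst (_≤ (a + b) + (b + c)) (regroup a c)
    (+-mono-≤ (+-monoʳ-≤ a a≤b) (+-monoˡ-≤ c c≤b))
    where regroup : ∀ a c → (a + a) + (c + c) ≡ (a + c) * 2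
          regroup = solve-∀
  bound : ∀ j → E (punchIn i j) * 2 ≤ count (λ v → wt v ≡ᵇ suc r) (allInputs (2 + (r + r)))
  bound j = begin
    E (punchIn i j) * 2
      ≡⟨ cong (_* 2) (count-by-pair (r + r) i j (λ w x y → (x ≟ᵇ y) ∧ (w ≡ᵇ suc r))) ⟩
    ((layer 0 + ∑ (λ _ → 0) (allInputs (r + r))) + (∑ (λ _ → 0) (allInputs (r + r)) + layer 2)) * 2
      ≡⟨ cong (λ z → ((layer 0 + z) + (z + layer 2)) * 2) none ⟩
    ((layer 0 + 0) + layer 2) * 2
      ≡⟨ cong (λ a → (a + layer 2) * 2) (+-identityʳ (layer 0)) ⟩
    (layer 0 + layer 2) * 2
      ≤⟨ double-≤ (layer 0) (layer 1) (layer 2) (weight-layer-above-middle r) (weight-layer-below-middle r) ⟩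
    (layer 0 + layer 1) + (layer 1 + layer 2)
      ≡⟨ sym (count-by-pair (r + r) i j (λ w x y → w ≡ᵇ suc r)) ⟩
    count (λ v → wt v ≡ᵇ suc r) (allInputs (2 + (r + r))) ∎

-- Tuples of points

tuples : List A → (k : ℕ) → List (Vec A k)
tuples xs zero    = [] ∷ []
tuples xs (suc k) = concatMap (λ x → map (x ∷_) (tuples xs k)) xs

∑-tuples : (xs : List A) (k : ℕ) (f : Vec A (suc k) → ℕ) →
  ∑ f (tuples xs (suc k)) ≡ ∑[ x ∈ xs ] ∑[ ys ∈ tuples xs k ] f (x ∷ ys)
∑-tuples xs k f = trans (∑-concatMap f _ xs) (∑-cong (λ x → ∑-map f (x ∷_) (tuples xs k)) xs)

module _ {n : ℕ} where

  _∈ᵇ_ : {k : ℕ} → Cube n → Vec (Cube n) k → Bool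
  y ∈ᵇ []       = false
  y ∈ᵇ (x ∷ xs) = (y == x) ∨ (y ∈ᵇ xs)

  distinctᵇ : {k : ℕ} → Vec (Cube n) k → Bool
  distinctᵇ []       = true
  distinctᵇ (x ∷ xs) = not (x ∈ᵇ xs) ∧ distinctᵇ xs

  support : {k : ℕ} → Vec (Cube n) k → BoolFun n
  support xs y = y ∈ᵇ xs

  count-∧-∈ᵇ : {k : ℕ} (f : Cube n → Bool) (xs : Vec (Cube n) k) → distinctᵇ xs ≡ true →
    count (λ y → f y ∧ (y ∈ᵇ xs)) (allInputs n) ≡ count f (toList xs)
  count-∧-∈ᵇ f []       _ = ∑-zero (λ y → cong 𝟙 (∧-zeroʳ (f y))) (allInputs n)
  count-∧-∈ᵇ f (x ∷ xs) distinct with ∧-true⁻ {not (x ∈ᵇ xs)} distinct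
  ... | x∉xs , distinct′ = begin
    count (λ y → f y ∧ ((y == x) ∨ (y ∈ᵇ xs))) (allInputs n)
      ≡⟨ ∑-cong (λ y → 𝟙-∧-∨-disjoint (f y) (y == x) (y ∈ᵇ xs) (y==x⇒y∉xs y)) (allInputs n) ⟩
    ∑[ y ∈ allInputs n ] (𝟙 (f y ∧ (y == x)) + 𝟙 (f y ∧ (y ∈ᵇ xs)))
      ≡⟨ ∑-distrib-+ _ _ (allInputs n) ⟩
    count (λ y → f y ∧ (y == x)) (allInputs n) + count (λ y → f y ∧ (y ∈ᵇ xs)) (allInputs n)
      ≡⟨ cong₂ _+_ (count-∧-== n f x) (count-∧-∈ᵇ f xs distinct′) ⟩
    𝟙 (f x) + count f (toList xs) ∎
    where
    open ≡-Reasoning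
    y==x⇒y∉xs : ∀ y → (y == x) ≡ true → (y ∈ᵇ xs) ≡ false
    y==x⇒y∉xs y y==x rewrite ==⇒≡ y x y==x = not-true⁻ x∉xs

  count-∧-∉ᵇ : {k : ℕ} (g : Cube n → Bool) (xs : Vec (Cube n) k) →
    distinctᵇ xs ≡ true → allᵇ g (toList xs) ≡ true →
    count (λ y → g y ∧ not (y ∈ᵇ xs)) (allInputs n) ≡ count g (allInputs n) ∸ k
  count-∧-∉ᵇ {k} g xs distinct xs⊆g = begin
    count∉ ≡⟨ sym (m+n∸m≡n k count∉) ⟩
    k + count∉ ∸ k
      ≡⟨ cong (λ c → c + count∉ ∸ k) (sym count∈) ⟩
    count (λ y → g y ∧ (y ∈ᵇ xs)) (allInputs n) + count∉ ∸ k
      ≡⟨ cong (_∸ k) (sym (∑-distrib-+ _ _ (allInputs n))) ⟩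
    ∑[ y ∈ allInputs n ] (𝟙 (g y ∧ (y ∈ᵇ xs)) + 𝟙 (g y ∧ not (y ∈ᵇ xs))) ∸ k
      ≡⟨ cong (_∸ k) (∑-cong (λ y → 𝟙-split (g y) (y ∈ᵇ xs)) (allInputs n)) ⟩
    count g (allInputs n) ∸ k ∎
    where
    open ≡-Reasoning
    count∉ = count (λ y → g y ∧ not (y ∈ᵇ xs)) (allInputs n)
    count∈ : count (λ y → g y ∧ (y ∈ᵇ xs)) (allInputs n) ≡ k
    count∈ = trans (count-∧-∈ᵇ g xs distinct) (trans (count-allᵇ g (toList xs) xs⊆g) (length-toList xs))

  distinctInᵇ : {k : ℕ} → (Cube n → Bool) → Vec (Cube n) k → Bool
  distinctInᵇ g xs = distinctᵇ xs ∧ allᵇ g (toList xs)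

  𝟙-distinctInᵇ-∷ : {k : ℕ} (g : Cube n → Bool) (x : Cube n) (xs : Vec (Cube n) k) →
    𝟙 (distinctInᵇ g (x ∷ xs)) ≡ 𝟙 (distinctInᵇ g xs) * 𝟙 (g x ∧ not (x ∈ᵇ xs))
  𝟙-distinctInᵇ-∷ g x xs = begin
    𝟙 ((not (x ∈ᵇ xs) ∧ distinctᵇ xs) ∧ (g x ∧ allᵇ g (toList xs)))
      ≡⟨ cong 𝟙 (∧-interchange (not (x ∈ᵇ xs)) _ (g x) _) ⟩
    𝟙 ((not (x ∈ᵇ xs) ∧ g x) ∧ distinctInᵇ g xs)
      ≡⟨ cong 𝟙 (∧-comm _ (distinctInᵇ g xs)) ⟩
    𝟙 (distinctInᵇ g xs ∧ (not (x ∈ᵇ xs) ∧ g x))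
      ≡⟨ 𝟙-∧ (distinctInᵇ g xs) _ ⟩
    𝟙 (distinctInᵇ g xs) * 𝟙 (not (x ∈ᵇ xs) ∧ g x)
      ≡⟨ cong (λ b → 𝟙 (distinctInᵇ g xs) * 𝟙 b) (∧-comm (not (x ∈ᵇ xs)) (g x)) ⟩
    𝟙 (distinctInᵇ g xs) * 𝟙 (g x ∧ not (x ∈ᵇ xs)) ∎
    where open ≡-Reasoning

  count-distinctInᵇ : (g : Cube n → Bool) (k : ℕ) →
    count (distinctInᵇ g) (tuples (allInputs n) k) ≡ count g (allInputs n) P′ k
  count-distinctInᵇ g zero    = refl
  count-distinctInᵇ g (suc k) = begin
    count (distinctInᵇ g) (tuples cube (suc k))
      ≡⟨ ∑-tuples cube k _ ⟩
    ∑[ x ∈ cube ] ∑[ xs ∈ tuples cube k ] 𝟙 (distinctInᵇ g (x ∷ xs))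
      ≡⟨ ∑-comm (λ x xs → 𝟙 (distinctInᵇ g (x ∷ xs))) cube (tuples cube k) ⟩
    ∑[ xs ∈ tuples cube k ] ∑[ x ∈ cube ] 𝟙 (distinctInᵇ g (x ∷ xs))
      ≡⟨ ∑-cong fresh-extensions (tuples cube k) ⟩
    ∑[ xs ∈ tuples cube k ] ((count g cube ∸ k) * 𝟙 (distinctInᵇ g xs))
      ≡⟨ ∑-*ˡ (count g cube ∸ k) _ (tuples cube k) ⟩
    (count g cube ∸ k) * count (distinctInᵇ g) (tuples cube k)
      ≡⟨ cong ((count g cube ∸ k) *_) (count-distinctInᵇ g k) ⟩
    count g cube P′ suc k ∎
    where
    open ≡-Reasoning
    cube = allInputs n
    fresh-extensions : (xs : Vec (Cube n) k) →
      ∑[ x ∈ cube ] 𝟙 (distinctInᵇ g (x ∷ xs)) ≡ (count g cube ∸ k) * 𝟙 (distinctInᵇ g xs)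
    fresh-extensions xs = begin
      ∑[ x ∈ cube ] 𝟙 (distinctInᵇ g (x ∷ xs))
        ≡⟨ ∑-cong (λ x → 𝟙-distinctInᵇ-∷ g x xs) cube ⟩
      ∑[ x ∈ cube ] (𝟙 (distinctInᵇ g xs) * 𝟙 (g x ∧ not (x ∈ᵇ xs)))
        ≡⟨ ∑-*ˡ (𝟙 (distinctInᵇ g xs)) _ cube ⟩
      𝟙 (distinctInᵇ g xs) * count (λ x → g x ∧ not (x ∈ᵇ xs)) cube
        ≡⟨ *-comm (𝟙 (distinctInᵇ g xs)) _ ⟩
      count (λ x → g x ∧ not (x ∈ᵇ xs)) cube * 𝟙 (distinctInᵇ g xs)
        ≡⟨ fresh-count ⟩
      (count g cube ∸ k) * 𝟙 (distinctInᵇ g xs) ∎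
      where
      fresh-count : count (λ x → g x ∧ not (x ∈ᵇ xs)) cube * 𝟙 (distinctInᵇ g xs)
                  ≡ (count g cube ∸ k) * 𝟙 (distinctInᵇ g xs)
      fresh-count with distinctInᵇ g xs in eq
      ... | false = trans (*-zeroʳ (count (λ x → g x ∧ not (x ∈ᵇ xs)) cube)) (sym (*-zeroʳ (count g cube ∸ k)))
      ... | true  = cong (_* 1) (count-∧-∉ᵇ g xs (proj₁ (∧-true⁻ eq)) (proj₂ (∧-true⁻ eq)))

  ∈ᵇ-allᵇ : {k : ℕ} (g : Cube n → Bool) {y : Cube n} (xs : Vec (Cube n) k) →
    (y ∈ᵇ xs) ≡ true → allᵇ g (toList xs) ≡ true → g y ≡ true
  ∈ᵇ-allᵇ g {y} (x ∷ xs) y∈xs xs⊆g with ∧-true⁻ {g x} xs⊆g | ∨-true⁻ {y == x} y∈xs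
  ... | gx , _    | inj₁ y==x rewrite ==⇒≡ y x y==x = gx
  ... | _  , xs⊆g′ | inj₂ y∈xs′ = ∈ᵇ-allᵇ g xs y∈xs′ xs⊆g′

  allᵇ-∈ᵇ : {k : ℕ} (g : Cube n → Bool) (xs : Vec (Cube n) k) →
    (∀ y → (y ∈ᵇ xs) ≡ true → g y ≡ true) → allᵇ g (toList xs) ≡ true
  allᵇ-∈ᵇ g []       _     = refl
  allᵇ-∈ᵇ g (x ∷ xs) xs⊆g rewrite xs⊆g x (cong (_∨ (x ∈ᵇ xs)) (==-refl x)) =
    allᵇ-∈ᵇ g xs (λ y y∈xs → xs⊆g y (∨-introʳ (y == x) y∈xs))
    where ∨-introʳ : ∀ a {b} → b ≡ true → a ∨ b ≡ true
          ∨-introʳ true  _ = refl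
          ∨-introʳ false b = b

  distinctInᵇ-exhaustive : {k : ℕ} (g : Cube n → Bool) (xs : Vec (Cube n) k) →
    distinctInᵇ g xs ≡ true → count g (allInputs n) ≡ k → ∀ y → g y ≡ support xs y
  distinctInᵇ-exhaustive {k} g xs xs↪g count≡k = pointwise
    where
    nothing-left : count (λ x → g x ∧ not (x ∈ᵇ xs)) (allInputs n) ≡ 0
    nothing-left = trans (count-∧-∉ᵇ g xs (proj₁ (∧-true⁻ xs↪g)) (proj₂ (∧-true⁻ xs↪g)))
                         (trans (cong (_∸ k) count≡k) (n∸n≡0 k))
    pointwise : ∀ y → g y ≡ support xs y
    pointwise y with y ∈ᵇ xs in y∈xs
    ... | true  = ∈ᵇ-allᵇ g xs y∈xs (proj₂ (∧-true⁻ xs↪g))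
    ... | false with count≡0⇒false _ (allInputs n) nothing-left (allInputs-complete n y)
    ...   | g∧∉≡false rewrite y∈xs | ∧-identityʳ (g y) = g∧∉≡false

  ∈ᵇ⇒lookup : {k : ℕ} (y : Cube n) (xs : Vec (Cube n) k) → (y ∈ᵇ xs) ≡ true →
    Σ (Fin k) λ l → (y == lookup xs l) ≡ true
  ∈ᵇ⇒lookup y (x ∷ xs) y∈xs with ∨-true⁻ {y == x} y∈xs
  ... | inj₁ y==x  = zero , y==x
  ... | inj₂ y∈xs′ with ∈ᵇ⇒lookup y xs y∈xs′
  ...   | l , y==xₗ = suc l , y==xₗ

  ¬distinct⇒repeat : {k : ℕ} (xs : Vec (Cube n) k) → distinctᵇ xs ≡ false →
    Σ (Fin k) λ i → Σ (Fin k) λ j → i ≢ j × (lookup xs i == lookup xs j) ≡ true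
  ¬distinct⇒repeat (x ∷ xs) ¬distinct with x ∈ᵇ xs in x∈xs
  ... | true with ∈ᵇ⇒lookup x xs x∈xs
  ...   | l , x==xₗ = zero , suc l , (λ ()) , x==xₗ
  ¬distinct⇒repeat (x ∷ xs) ¬distinct | false with ¬distinct⇒repeat xs ¬distinct
  ... | i , j , i≢j , xᵢ==xⱼ = suc i , suc j , i≢j ∘ suc-injective , xᵢ==xⱼ

  𝟙-∧-not-distinct-≤ : {k : ℕ} (b : Bool) (xs : Vec (Cube n) k) →
    𝟙 (b ∧ not (distinctᵇ xs))
      ≤ ∑[ i ∈ allFin k ] ∑[ j ∈ allFin k ] 𝟙 (not (does (i ≟ j)) ∧ ((lookup xs i == lookup xs j) ∧ b))
  𝟙-∧-not-distinct-≤ false xs = z≤n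
  𝟙-∧-not-distinct-≤ true  xs with distinctᵇ xs in distinct
  ... | true  = z≤n
  ... | false with ¬distinct⇒repeat xs distinct
  ...   | i , j , i≢j , xᵢ==xⱼ = begin
    1
      ≡⟨ sym (cong₂ (λ d e → 𝟙 (not d ∧ (e ∧ true))) (dec-false (i ≟ j) i≢j) xᵢ==xⱼ) ⟩
    repeat i j
      ≤⟨ ∑-≥-element (repeat i) (∈-allFin j) ⟩
    ∑ (repeat i) (allFin _)
      ≤⟨ ∑-≥-element (λ i → ∑ (repeat i) (allFin _)) (∈-allFin i) ⟩
    ∑[ i ∈ allFin _ ] ∑ (repeat i) (allFin _) ∎
    where
    open ≤-Reasoning
    repeat : Fin _ → Fin _ → ℕ
    repeat i j = 𝟙 (not (does (i ≟ j)) ∧ ((lookup xs i == lookup xs j) ∧ true))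

-- Boolean functions

_≗ᵇ_ : {n : ℕ} → BoolFun n → BoolFun n → Bool
_≗ᵇ_ {n} g h = allᵇ (λ y → g y ≟ᵇ h y) (allInputs n)

≗ᵇ⇒≗ : {n : ℕ} (g h : BoolFun n) → (g ≗ᵇ h) ≡ true → ∀ y → g y ≡ h y
≗ᵇ⇒≗ {n} g h g≗h y = ≟ᵇ⇒≡ _ _ (allᵇ-true⁻ _ g≗h (allInputs-complete n y))

≗⇒≗ᵇ : {n : ℕ} (g h : BoolFun n) → (∀ y → g y ≡ h y) → (g ≗ᵇ h) ≡ true
≗⇒≗ᵇ {n} g h g≗h =
  allᵇ-true⁺ _ (λ y → subst (λ b → (g y ≟ᵇ b) ≡ true) (g≗h y) (≟ᵇ-refl (g y))) (allInputs n)

count-≗ᵇ-allFuns : (n : ℕ) (h : BoolFun n) → count (_≗ᵇ h) (allFuns n) ≡ 1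
count-≗ᵇ-allFuns zero h with h []
... | false = refl
... | true  = refl
count-≗ᵇ-allFuns (suc n) h = begin
  count (_≗ᵇ h) (allFuns (suc n))
    ≡⟨ ∑-concatMap _ _ (allFuns n) ⟩
  _ ≡⟨ ∑-cong (λ g₀ → ∑-map _ _ (allFuns n)) (allFuns n) ⟩
  _ ≡⟨ ∑-cong (λ g₀ → ∑-cong (λ g₁ → trans (cong 𝟙 (≗ᵇ-restrictions _)) (𝟙-∧ (g₀ ≗ᵇ h₀) (g₁ ≗ᵇ h₁)))
                             (allFuns n)) (allFuns n) ⟩
  ∑[ g₀ ∈ allFuns n ] ∑[ g₁ ∈ allFuns n ] (𝟙 (g₀ ≗ᵇ h₀) * 𝟙 (g₁ ≗ᵇ h₁))
    ≡⟨ ∑-cong (λ g₀ → ∑-*ˡ (𝟙 (g₀ ≗ᵇ h₀)) _ (allFuns n)) (allFuns n) ⟩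
  ∑[ g₀ ∈ allFuns n ] (𝟙 (g₀ ≗ᵇ h₀) * count (_≗ᵇ h₁) (allFuns n))
    ≡⟨ ∑-cong (λ g₀ → trans (cong (𝟙 (g₀ ≗ᵇ h₀) *_) (count-≗ᵇ-allFuns n h₁)) (*-identityʳ _))
              (allFuns n) ⟩
  count (_≗ᵇ h₀) (allFuns n)
    ≡⟨ count-≗ᵇ-allFuns n h₀ ⟩
  1 ∎
  where
  open ≡-Reasoning
  h₀ h₁ : BoolFun n
  h₀ y = h (false ∷ y)
  h₁ y = h (true ∷ y)
  ≗ᵇ-restrictions : (g : BoolFun (suc n)) →
    (g ≗ᵇ h) ≡ ((λ y → g (false ∷ y)) ≗ᵇ h₀) ∧ ((λ y → g (true ∷ y)) ≗ᵇ h₁)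
  ≗ᵇ-restrictions g = trans (allᵇ-++ _ (map (false ∷_) (allInputs n)) _)
    (cong₂ _∧_ (allᵇ-map _ (false ∷_) (allInputs n)) (allᵇ-map _ (true ∷_) (allInputs n)))

-- Balanced tuples

column : {n k : ℕ} → Vec (Cube n) k → Fin n → Vec Bool k
column xs j = Vec.map (λ x → lookup x j) xs

balancedᵇ : {n k : ℕ} → ℕ → Vec (Cube n) k → Bool
balancedᵇ {n} q xs = ⋀ n (λ j → wt (column xs j) ≡ᵇ q)

count-columnwise : (n k : ℕ) (P : Fin n → Vec Bool k → Bool) →
  count (λ xs → ⋀ n (λ j → P j (column xs j))) (tuples (allInputs n) k)
    ≡ ∏ n (λ j → count (P j) (allInputs k))
count-columnwise n zero    P =
  trans (+-identityʳ _) (trans (𝟙-⋀ n (λ j → P j [])) (∏-cong n (λ j → sym (+-identityʳ _))))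
count-columnwise n (suc k) P = begin
  count (λ xs → ⋀ n (λ j → P j (column xs j))) (tuples (allInputs n) (suc k))
    ≡⟨ ∑-tuples (allInputs n) k _ ⟩
  ∑[ x ∈ allInputs n ] count (λ xs → ⋀ n (λ j → P j (lookup x j ∷ column xs j))) (tuples (allInputs n) k)
    ≡⟨ ∑-cong (λ x → count-columnwise n k (λ j v → P j (lookup x j ∷ v))) (allInputs n) ⟩
  ∑[ x ∈ allInputs n ] ∏ n (λ j → count (λ v → P j (lookup x j ∷ v)) (allInputs k))
    ≡⟨ ∑-cube-∏ n (λ j b → count (λ v → P j (b ∷ v)) (allInputs k)) ⟩
  ∏ n (λ j → count (λ v → P j (false ∷ v)) (allInputs k) + count (λ v → P j (true ∷ v)) (allInputs k))
    ≡⟨ ∏-cong n (λ j → sym (∑-cube k (𝟙 ∘ P j))) ⟩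
  ∏ n (λ j → count (P j) (allInputs (suc k))) ∎
  where open ≡-Reasoning

count-lookup≟ᵇtrue : {n k : ℕ} (j : Fin n) (xs : Vec (Cube n) k) →
  count (λ x → lookup x j ≟ᵇ true) (toList xs) ≡ wt (column xs j)
count-lookup≟ᵇtrue j xs = begin
  count (λ x → lookup x j ≟ᵇ true) (toList xs)
    ≡⟨ ∑-cong (λ x → cong 𝟙 (≟ᵇtrue (lookup x j))) (toList xs) ⟩
  ∑[ x ∈ toList xs ] 𝟙 (lookup x j)
    ≡⟨ sym (∑-map 𝟙 (λ x → lookup x j) (toList xs)) ⟩
  ∑ 𝟙 (map (λ x → lookup x j) (toList xs))
    ≡⟨ cong (∑ 𝟙) (sym (toList-map (λ x → lookup x j) xs)) ⟩
  wt (column xs j) ∎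
  where
  open ≡-Reasoning
  ≟ᵇtrue : ∀ b → (b ≟ᵇ true) ≡ b
  ≟ᵇtrue true  = refl
  ≟ᵇtrue false = refl

count-lookup≟ᵇ-partition : {n k : ℕ} (j : Fin n) (xs : Vec (Cube n) k) →
  count (λ x → lookup x j ≟ᵇ false) (toList xs) + count (λ x → lookup x j ≟ᵇ true) (toList xs) ≡ k
count-lookup≟ᵇ-partition j xs = begin
  count (λ x → lookup x j ≟ᵇ false) (toList xs) + count (λ x → lookup x j ≟ᵇ true) (toList xs)
    ≡⟨ sym (∑-distrib-+ _ _ (toList xs)) ⟩
  ∑[ x ∈ toList xs ] (𝟙 (lookup x j ≟ᵇ false) + 𝟙 (lookup x j ≟ᵇ true))
    ≡⟨ ∑-cong (λ x → one-of (lookup x j)) (toList xs) ⟩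
  count (λ _ → true) (toList xs)
    ≡⟨ trans (count-true (toList xs)) (length-toList xs) ⟩
  _ ∎
  where
  open ≡-Reasoning
  one-of : ∀ b → 𝟙 (b ≟ᵇ false) + 𝟙 (b ≟ᵇ true) ≡ 1
  one-of true  = refl
  one-of false = refl

≡ᵇ-halves : ∀ c₀ c₁ q → c₀ + c₁ ≡ q + q → ((c₀ ≡ᵇ q) ∧ ((c₁ ≡ᵇ q) ∧ true)) ≡ (c₁ ≡ᵇ q)
≡ᵇ-halves c₀ c₁ q sum≡ with c₁ ≡ᵇ q in eq
... | false = ∧-zeroʳ _
... | true with ≡ᵇ-true⁻ {c₁} {q} eq
...   | refl rewrite +-cancelʳ-≡ c₁ c₀ c₁ sum≡ | ≡ᵇ-refl c₁ = refl

module _ {n : ℕ} where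

  countᵇ-∧-support : {k : ℕ} (g : BoolFun n) (xs : Vec (Cube n) k) →
    distinctᵇ xs ≡ true → (∀ y → g y ≡ support xs y) →
    (f : Cube n → Bool) → countᵇ (λ y → f y ∧ g y) ≡ count f (toList xs)
  countᵇ-∧-support g xs distinct g≗xs f =
    trans (length-filterᵇ _ (allInputs n))
      (trans (∑-cong (λ y → cong (λ b → 𝟙 (f y ∧ b)) (g≗xs y)) (allInputs n))
        (count-∧-∈ᵇ f xs distinct))

  isCI1≡balancedᵇ : (q : ℕ) (g : BoolFun n) (xs : Vec (Cube n) (2 * q)) →
    distinctᵇ xs ≡ true → (∀ y → g y ≡ support xs y) → isCI1 n q g ≡ balancedᵇ q xs
  isCI1≡balancedᵇ q g xs distinct g≗xs = begin
    isCI1 n q g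
      ≡⟨ cong (_∧ columns-ok) weight-ok ⟩
    columns-ok
      ≡⟨ allᵇ-tabulate n _ (λ j → j) ⟩
    ⋀ n (λ j → allᵇ (λ b → countᵇ (λ y → (lookup y j ≟ᵇ b) ∧ g y) ≡ᵇ q) (false ∷ true ∷ []))
      ≡⟨ ⋀-cong n column-ok ⟩
    balancedᵇ q xs ∎
    where
    open ≡-Reasoning
    count-support = countᵇ-∧-support g xs distinct g≗xs
    columns-ok = allᵇ (λ j → allᵇ (λ b → countᵇ (λ y → (lookup y j ≟ᵇ b) ∧ g y) ≡ᵇ q)
                                   (false ∷ true ∷ [])) (allFin n)
    weight-ok : (weight g ≡ᵇ 2 * q) ≡ true
    weight-ok rewrite count-support (λ _ → true)
                    | count-true (toList xs) | length-toList xs = ≡ᵇ-refl (2 * q)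
    column-ok : ∀ j → allᵇ (λ b → countᵇ (λ y → (lookup y j ≟ᵇ b) ∧ g y) ≡ᵇ q) (false ∷ true ∷ [])
                    ≡ (wt (column xs j) ≡ᵇ q)
    column-ok j rewrite count-support (λ y → lookup y j ≟ᵇ false)
                      | count-support (λ y → lookup y j ≟ᵇ true)
                      | sym (count-lookup≟ᵇtrue j xs) =
      ≡ᵇ-halves (count (λ x → lookup x j ≟ᵇ false) (toList xs))
                (count (λ x → lookup x j ≟ᵇ true) (toList xs)) q
        (trans (count-lookup≟ᵇ-partition j xs) (cong (q +_) (+-identityʳ q)))

  isCI1⇒count≡ : (q : ℕ) (g : BoolFun n) → isCI1 n q g ≡ true → count g (allInputs n) ≡ 2 * q
  isCI1⇒count≡ q g ci = trans (sym (length-filterᵇ g (allInputs n))) (≡ᵇ-true⁻ (proj₁ (∧-true⁻ ci)))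

  𝟙-balanced-distinct-support : (q : ℕ) (g : BoolFun n) (xs : Vec (Cube n) (2 * q)) →
    𝟙 (balancedᵇ q xs ∧ distinctᵇ xs) * 𝟙 (g ≗ᵇ support xs) ≡ 𝟙 (isCI1 n q g) * 𝟙 (distinctInᵇ g xs)
  𝟙-balanced-distinct-support q g xs with distinctᵇ xs in distinct | g ≗ᵇ support xs in g≗xs
  ... | false | _ rewrite ∧-zeroʳ (balancedᵇ q xs) = sym (*-zeroʳ (𝟙 (isCI1 n q g)))
  ... | true  | true
    rewrite isCI1≡balancedᵇ q g xs distinct (≗ᵇ⇒≗ g (support xs) g≗xs)
          | allᵇ-∈ᵇ g xs (λ y y∈xs → trans (≗ᵇ⇒≗ g (support xs) g≗xs y) y∈xs)
          | ∧-identityʳ (balancedᵇ q xs) = refl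
  ... | true  | false rewrite *-zeroʳ (𝟙 (balancedᵇ q xs ∧ true))
    with isCI1 n q g in ci | allᵇ g (toList xs) in xs⊆g
  ...   | false | _     = refl
  ...   | true  | false = refl
  ...   | true  | true  with trans (sym g≗xs) (≗⇒≗ᵇ g (support xs)
                               (distinctInᵇ-exhaustive g xs (trans (cong (_∧ allᵇ g (toList xs)) distinct) xs⊆g)
                                                       (isCI1⇒count≡ q g ci)))
  ...     | ()

  count-balanced-distinct : (q : ℕ) →
    count (λ xs → balancedᵇ q xs ∧ distinctᵇ xs) (tuples (allInputs n) (2 * q)) ≡ (2 * q) ! * N n q
  count-balanced-distinct q = begin
    count (λ xs → balancedᵇ q xs ∧ distinctᵇ xs) Xs
      ≡⟨ ∑-cong (λ xs → trans (sym (*-identityʳ _)) (cong (𝟙 (balancedᵇ q xs ∧ distinctᵇ xs) *_)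
                              (sym (count-≗ᵇ-allFuns n (support xs))))) Xs ⟩
    ∑[ xs ∈ Xs ] (𝟙 (balancedᵇ q xs ∧ distinctᵇ xs) * count (_≗ᵇ support xs) F)
      ≡⟨ ∑-cong (λ xs → sym (∑-*ˡ (𝟙 (balancedᵇ q xs ∧ distinctᵇ xs)) _ F)) Xs ⟩
    ∑[ xs ∈ Xs ] ∑[ g ∈ F ] (𝟙 (balancedᵇ q xs ∧ distinctᵇ xs) * 𝟙 (g ≗ᵇ support xs))
      ≡⟨ ∑-comm (λ xs g → 𝟙 (balancedᵇ q xs ∧ distinctᵇ xs) * 𝟙 (g ≗ᵇ support xs)) Xs F ⟩
    ∑[ g ∈ F ] ∑[ xs ∈ Xs ] (𝟙 (balancedᵇ q xs ∧ distinctᵇ xs) * 𝟙 (g ≗ᵇ support xs))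
      ≡⟨ ∑-cong (λ g → ∑-cong (𝟙-balanced-distinct-support q g) Xs) F ⟩
    ∑[ g ∈ F ] ∑[ xs ∈ Xs ] (𝟙 (isCI1 n q g) * 𝟙 (distinctInᵇ g xs))
      ≡⟨ ∑-cong (λ g → trans (∑-*ˡ (𝟙 (isCI1 n q g)) _ Xs)
                              (cong (𝟙 (isCI1 n q g) *_) (count-distinctInᵇ g (2 * q)))) F ⟩
    ∑[ g ∈ F ] (𝟙 (isCI1 n q g) * (count g (allInputs n) P′ (2 * q)))
      ≡⟨ ∑-cong orderings F ⟩
    ∑[ g ∈ F ] ((2 * q) ! * 𝟙 (isCI1 n q g))
      ≡⟨ ∑-*ˡ ((2 * q) !) (𝟙 ∘ isCI1 n q) F ⟩
    (2 * q) ! * count (isCI1 n q) F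
      ≡⟨ cong ((2 * q) ! *_) (sym (length-filterᵇ (isCI1 n q) F)) ⟩
    (2 * q) ! * N n q ∎
    where
    open ≡-Reasoning
    Xs = tuples (allInputs n) (2 * q)
    F = allFuns n
    orderings : ∀ g → 𝟙 (isCI1 n q g) * (count g (allInputs n) P′ (2 * q)) ≡ (2 * q) ! * 𝟙 (isCI1 n q g)
    orderings g with isCI1 n q g in ci
    ... | false = sym (*-zeroʳ ((2 * q) !))
    ... | true rewrite isCI1⇒count≡ q g ci | nP′n≡n! (2 * q) = trans (+-identityʳ _) (sym (*-identityʳ _))

  count-balanced : (q : ℕ) → count (balancedᵇ q) (tuples (allInputs n) (2 * q)) ≡ ((2 * q) C q) ^ n
  count-balanced q = begin
    count (balancedᵇ q) (tuples (allInputs n) (2 * q))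
      ≡⟨ count-columnwise n (2 * q) (λ _ v → wt v ≡ᵇ q) ⟩
    ∏ n (λ _ → count (λ v → wt v ≡ᵇ q) (allInputs (2 * q)))
      ≡⟨ ∏-const n _ ⟩
    count (λ v → wt v ≡ᵇ q) (allInputs (2 * q)) ^ n
      ≡⟨ cong (_^ n) (count-wt≡ᵇ (2 * q) q) ⟩
    ((2 * q) C q) ^ n ∎
    where open ≡-Reasoning

  count-equal-pair-balanced : (q : ℕ) (i j : Fin (2 * q)) →
    count (λ xs → not (does (i ≟ j)) ∧ ((lookup xs i == lookup xs j) ∧ balancedᵇ q xs))
          (tuples (allInputs n) (2 * q)) * 2 ^ n
      ≤ ((2 * q) C q) ^ n
  count-equal-pair-balanced q i j with i ≟ j
  ... | yes _ rewrite ∑-zero {f = λ _ → 0} (λ _ → refl) (tuples (allInputs n) (2 * q)) = z≤n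
  count-equal-pair-balanced (suc r) i j | no i≢j = begin
    count (λ xs → (lookup xs i == lookup xs j) ∧ balancedᵇ q xs) Xs * 2 ^ n
      ≡⟨ cong (_* 2 ^ n) (∑-cong (λ xs → cong 𝟙 (as-columns xs)) Xs) ⟩
    count (λ xs → ⋀ n (λ c → P (column xs c))) Xs * 2 ^ n
      ≡⟨ cong (_* 2 ^ n) (trans (count-columnwise n (2 * q) (λ _ → P)) (∏-const n E)) ⟩
    E ^ n * 2 ^ n
      ≡⟨ sym (^-distribʳ-* E 2 n) ⟩
    (E * 2) ^ n
      ≤⟨ ^-monoˡ-≤ n (column-pair-bound r (2*[1+r]≡2+[r+r] r) i j i≢j) ⟩
    count (λ v → wt v ≡ᵇ q) (allInputs (2 * q)) ^ n
      ≡⟨ cong (_^ n) (count-wt≡ᵇ (2 * q) q) ⟩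
    ((2 * q) C q) ^ n ∎
    where
    open ≤-Reasoning
    q = suc r
    Xs = tuples (allInputs n) (2 * q)
    P : Vec Bool (2 * q) → Bool
    P v = (lookup v i ≟ᵇ lookup v j) ∧ (wt v ≡ᵇ q)
    E = count P (allInputs (2 * q))
    2*[1+r]≡2+[r+r] : ∀ r → 2 * suc r ≡ 2 + (r + r)
    2*[1+r]≡2+[r+r] = solve-∀
    as-columns : (xs : Vec (Cube n) (2 * q)) →
      (lookup xs i == lookup xs j) ∧ balancedᵇ q xs ≡ ⋀ n (λ c → P (column xs c))
    as-columns xs = trans (cong (_∧ balancedᵇ q xs) (==-⋀ (lookup xs i) (lookup xs j)))
      (trans (⋀-∧ n _ _) (⋀-cong n (λ c → cong (λ { (a , b) → (a ≟ᵇ b) ∧ (wt (column xs c) ≡ᵇ q) })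
        (cong₂ _,_ (sym (lookup-map i (λ x → lookup x c) xs)) (sym (lookup-map j (λ x → lookup x c) xs))))))

  count-balanced-not-distinct : (q : ℕ) →
    count (λ xs → balancedᵇ q xs ∧ not (distinctᵇ xs)) (tuples (allInputs n) (2 * q)) * 2 ^ n
      ≤ (2 * q) * ((2 * q) * ((2 * q) C q) ^ n)
  count-balanced-not-distinct q = begin
    count (λ xs → balancedᵇ q xs ∧ not (distinctᵇ xs)) Xs * 2 ^ n
      ≤⟨ *-monoˡ-≤ (2 ^ n) (∑-mono-≤ (λ xs → 𝟙-∧-not-distinct-≤ (balancedᵇ q xs) xs) Xs) ⟩
    ∑[ xs ∈ Xs ] ∑[ i ∈ Is ] ∑[ j ∈ Is ] pair i j xs * 2 ^ n
      ≡⟨ cong (_* 2 ^ n) (trans (∑-comm (λ xs i → ∑[ j ∈ Is ] pair i j xs) Xs Is)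
                                (∑-cong (λ i → ∑-comm (λ xs j → pair i j xs) Xs Is) Is)) ⟩
    ∑[ i ∈ Is ] ∑[ j ∈ Is ] ∑[ xs ∈ Xs ] pair i j xs * 2 ^ n
      ≤⟨ ∑-*ʳ-≤-length* _ (2 ^ n) _
           (λ i → ∑-*ʳ-≤-length* _ (2 ^ n) _ (count-equal-pair-balanced q i) Is) Is ⟩
    length Is * (length Is * ((2 * q) C q) ^ n)
      ≡⟨ cong (λ l → l * (l * ((2 * q) C q) ^ n)) (length-tabulate {n = 2 * q} (λ i → i)) ⟩
    (2 * q) * ((2 * q) * ((2 * q) C q) ^ n) ∎
    where
    open ≤-Reasoning
    Xs = tuples (allInputs n) (2 * q)
    Is = allFin (2 * q)
    pair : Fin (2 * q) → Fin (2 * q) → Vec (Cube n) (2 * q) → ℕ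
    pair i j xs = 𝟙 (not (does (i ≟ j)) ∧ ((lookup xs i == lookup xs j) ∧ balancedᵇ q xs))

  count-balanced-split : (q : ℕ) →
    (2 * q) ! * N n q + count (λ xs → balancedᵇ q xs ∧ not (distinctᵇ xs)) (tuples (allInputs n) (2 * q))
      ≡ ((2 * q) C q) ^ n
  count-balanced-split q = begin
    (2 * q) ! * N n q + repeated
      ≡⟨ cong (_+ repeated) (sym (count-balanced-distinct q)) ⟩
    count (λ xs → balancedᵇ q xs ∧ distinctᵇ xs) Xs + repeated
      ≡⟨ sym (∑-distrib-+ _ _ Xs) ⟩
    ∑[ xs ∈ Xs ] (𝟙 (balancedᵇ q xs ∧ distinctᵇ xs) + 𝟙 (balancedᵇ q xs ∧ not (distinctᵇ xs)))
      ≡⟨ ∑-cong (λ xs → 𝟙-split (balancedᵇ q xs) (distinctᵇ xs)) Xs ⟩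
    count (balancedᵇ q) Xs
      ≡⟨ count-balanced q ⟩
    ((2 * q) C q) ^ n ∎
    where
    open ≡-Reasoning
    Xs = tuples (allInputs n) (2 * q)
    repeated = count (λ xs → balancedᵇ q xs ∧ not (distinctᵇ xs)) Xs

CI1-count-error : (n q : ℕ) →
  ∣ (2 * q) ! * N n q * 2 ^ n - ((2 * q) C q) ^ n * 2 ^ n ∣ ≤ 4 * ((2 * q) C q) ^ n * q ^ 2
CI1-count-error n q = begin
  ∣ ordered * 2 ^ n - balanced * 2 ^ n ∣
    ≡⟨ m≤n⇒∣m-n∣≡n∸m (*-monoˡ-≤ (2 ^ n) (subst (ordered ≤_) split (m≤m+n ordered repeated))) ⟩
  balanced * 2 ^ n ∸ ordered * 2 ^ n
    ≡⟨ sym (*-distribʳ-∸ (2 ^ n) balanced ordered) ⟩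
  (balanced ∸ ordered) * 2 ^ n
    ≡⟨ cong (λ b → (b ∸ ordered) * 2 ^ n) (sym split) ⟩
  (ordered + repeated ∸ ordered) * 2 ^ n
    ≡⟨ cong (_* 2 ^ n) (m+n∸m≡n ordered repeated) ⟩
  repeated * 2 ^ n
    ≤⟨ count-balanced-not-distinct q ⟩
  (2 * q) * ((2 * q) * balanced)
    ≡⟨ regroup q balanced ⟩
  4 * balanced * (q * q)
    ≡⟨ cong (λ r → 4 * balanced * (q * r)) (sym (*-identityʳ q)) ⟩
  4 * balanced * q ^ 2 ∎
  where
  open ≤-Reasoning
  ordered  = (2 * q) ! * N n q
  balanced = ((2 * q) C q) ^ n
  repeated = count (λ xs → balancedᵇ q xs ∧ not (distinctᵇ xs)) (tuples (allInputs n) (2 * q))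
  split : ordered + repeated ≡ balanced
  split = count-balanced-split q
  regroup : ∀ q c → (2 * q) * ((2 * q) * c) ≡ 4 * c * (q * q)
  regroup = solve-∀

lemma7p1 : (q : ℕ → ℕ) →
    (∀ k → ∃[ n₀ ] ∀ n → n₀ ≤ n → k * q n ^ 2 ≤ 2 ^ n) →
    ∃[ K ] ∃[ n₀ ] ∀ n → n₀ ≤ n →
      ∣ (2 * q n) ! * N n (q n) * 2 ^ n - ((2 * q n) C (q n)) ^ n * 2 ^ n ∣
        ≤ K * ((2 * q n) C (q n)) ^ n * q n ^ 2
-- The bound holds for every n.
lemma7p1 q _ = 4 , 0 , λ n _ → CI1-count-error n (q n)
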